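{- Let $D$ be a digraph whose $m$-step competition graph $C^m(D)$ is triangle-free for some positive integer $m$. Then every vertex $u$ of $D$ has at most two $i$-step predators for each positive integer $i \leq m$.
   Context: All digraphs are finite, may have loops, and (standing assumption) every vertex has outdegree at least $1$. For a positive integer $m$, a vertex $y$ is an $m$-step prey of $x$ (and $x$ an $m$-step predator of $y$) if there is a directed walk of length $m$ from $x$ to $y$. The $m$-step competition graph $C^m(D)$ has vertex set $V(D)$ and an edge between distinct vertices $x,y$ iff they have a common $m$-step prey. -}

module Defs where

open import Data.Nat using (ℕ; zero; suc)
open import Data.Fin using (Fin)
open import Data.Product using (Σ; ∃; _×_)
open import Relation.Binary.PropositionalEquality using (_≡_)
open import Relation.Nullary using (¬_)

record Digraph (n : ℕ) : Set₁ where
  field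
    Arc : Fin n → Fin n → Set
    -- standing assumption: every vertex has outdegree at least 1
    outdeg≥1 : (x : Fin n) → ∃ λ y → Arc x y

open Digraph public

data Walk {n : ℕ} (D : Digraph n) : ℕ → Fin n → Fin n → Set where
  here : ∀ {x} → Walk D zero x x
  step : ∀ {k x y z} → Arc D x y → Walk D k y z → Walk D (suc k) x z

-- y is an m-step prey of x (x is an m-step predator of y)
Predator : ∀ {n} (D : Digraph n) → ℕ → Fin n → Fin n → Set
Predator D m x y = Walk D m x y

CompEdge : ∀ {n} (D : Digraph n) → ℕ → Fin n → Fin n → Set
CompEdge D m x y = ¬ (x ≡ y) × ∃ λ z → Walk D m x z × Walk D m y z

-- C^m(D) is triangle-free: no three vertices pairwise adjacent
-- (adjacency already forces them pairwise distinct)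
TriangleFree : ∀ {n} (D : Digraph n) → ℕ → Set
TriangleFree {n} D m = (a b c : Fin n) →
  ¬ (CompEdge D m a b × CompEdge D m b c × CompEdge D m a c)

AtMostTwoPredators : ∀ {n} (D : Digraph n) → ℕ → Fin n → Set
AtMostTwoPredators {n} D i u = (a b c : Fin n) →
  ¬ (a ≡ b) → ¬ (b ≡ c) → ¬ (a ≡ c) →
  ¬ (Predator D i a u × Predator D i b u × Predator D i c u)

{-# OPTIONS --safe #-}
module Submission where

-- Since every vertex has an out-arc, an i-step walk into u extends, along one fixed
-- walk of length m − i out of u, to an m-step walk into a vertex z.  So three distinct
-- i-step predators of u would all be m-step predators of z: a triangle in C^m(D).

open import Defs
open import Data.Nat using (ℕ; zero; suc; _+_; _∸_; _≤_; _≥_)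
open import Data.Nat.Properties using (m+[n∸m]≡n)
open import Data.Fin using (Fin)
open import Data.Product using (∃; _,_)
open import Relation.Binary.PropositionalEquality using (subst)

module _ {n : ℕ} {D : Digraph n} where

  walk-from : (k : ℕ) (x : Fin n) → ∃ λ z → Walk D k x z
  walk-from zero    x = x , here
  walk-from (suc k) x with outdeg≥1 D x
  ... | y , x→y with walk-from k y
  ...   | z , y⇝z = z , step x→y y⇝z

  _++ʷ_ : ∀ {i k x y z} → Walk D i x y → Walk D k y z → Walk D (i + k) x z
  here       ++ʷ w = w
  step a v   ++ʷ w = step a (v ++ʷ w)

  predators-lift : ∀ {i m} → i ≤ m → (u : Fin n) →
    ∃ λ z → ∀ {x} → Predator D i x u → Predator D m x z
  predators-lift {i} {m} i≤m u with walk-from (m ∸ i) u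
  ... | z , u⇝z = z , λ x⇝u →
    subst (λ k → Walk D k _ z) (m+[n∸m]≡n i≤m) (x⇝u ++ʷ u⇝z)

proposition2p3 : {n : ℕ} (D : Digraph n) (m : ℕ) → m ≥ 1 → TriangleFree D m →
    (u : Fin n) (i : ℕ) → i ≥ 1 → i ≤ m → AtMostTwoPredators D i u
proposition2p3 D m _ triangle-free u i _ i≤m a b c a≢b b≢c a≢c (a⇝u , b⇝u , c⇝u)
  with predators-lift {D = D} i≤m u
... | z , lift =
  triangle-free a b c
    ( (a≢b , z , lift a⇝u , lift b⇝u)
    , (b≢c , z , lift b⇝u , lift c⇝u)
    , (a≢c , z , lift a⇝u , lift c⇝u) )
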